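{- Let $Y$ be a Young diagram with row lengths $a_1\ge\cdots\ge a_m\ge 0$. For any $Q\subseteq C\times S$ there exists a 2-cover $P$ of $H(Y)$ such that $P\cap(C\times S)=Q$ and \[\tau^{(2)}(H(Y))\le |P|=|Q|+\sum_{i=1}^m \nu(a_i,Q).\]
   Context: $H(Y)$ is the tripartite 3-uniform hypergraph with sides $R=\{r_1,\dots,r_m\}$, $C=\{c_1,\dots,c_{a_1}\}$, $S=\{s_1,\dots,s_{a_1}\}$ and edge set $\bigcup_{i=1}^m\{\{r_i,c_j,s_k\}: 1\le j,k\le a_i\}$. For disjoint sets $A,B$, $A\times B=\{\{a,b\}: a\in A,b\in B\}$. A 2-cover of $H(Y)$ is a set $P\subseteq (R\times C)\cup(R\times S)\cup(C\times S)$ such that every edge of $H(Y)$ contains at least one pair of $P$; $\tau^{(2)}(H(Y))$ is the minimum size of a 2-cover. For an integer $\ell\ge0$ and $Q\subseteq C\times S$, $\nu(\ell,Q)$ is the matching number of the bipartite graph on $\{c_1,\dots,c_\ell\}\cup\{s_1,\dots,s_\ell\}$ with edge set $\{\{c_j,s_k\}: j,k\le\ell\}\setminus Q$. -}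

module Defs where

open import Data.Nat using (ℕ; zero; suc; _+_; _≤_; _<_)
open import Data.Fin using (Fin; toℕ)
open import Data.Bool using (Bool; true; false; T; _∨_; if_then_else_)
open import Data.List using (List; length)
open import Data.Product using (_×_; _,_; proj₁; proj₂; Σ; ∃)
open import Data.List.Relation.Unary.All using (All)
open import Data.List.Relation.Unary.AllPairs using (AllPairs)
open import Relation.Binary.PropositionalEquality using (_≡_)
open import Relation.Nullary using (¬_)

Σᶠ : (k : ℕ) → (Fin k → ℕ) → ℕ
Σᶠ zero    f = 0
Σᶠ (suc k) f = f Data.Fin.zero + Σᶠ k (λ i → f (Data.Fin.suc i))

count : (k : ℕ) → (Fin k → Bool) → ℕ
count k f = Σᶠ k (λ i → if f i then 1 else 0)

count₂ : (k l : ℕ) → (Fin k → Fin l → Bool) → ℕ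
count₂ k l f = Σᶠ k (λ i → count l (f i))

IsYoung : (m : ℕ) → (Fin m → ℕ) → Set
IsYoung m a = ∀ (i j : Fin m) → toℕ i ≤ toℕ j → a j ≤ a i

width : (m : ℕ) → (Fin m → ℕ) → ℕ
width zero    a = 0
width (suc m) a = a Data.Fin.zero

-- A subset of pairs of R × C ∪ R × S ∪ C × S, where R = Fin m, C = S = Fin n,
-- given by its three Boolean incidence matrices.
record PairSet (m n : ℕ) : Set where
  field
    RC : Fin m → Fin n → Bool
    RS : Fin m → Fin n → Bool
    CS : Fin n → Fin n → Bool
open PairSet public

size : ∀ {m n} → PairSet m n → ℕ
size {m} {n} P = count₂ m n (RC P) + count₂ m n (RS P) + count₂ n n (CS P)

-- P is a 2-cover of H(Y): every edge {r_i, c_j, s_k} with j,k ≤ a_i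
-- (0-indexed: toℕ j < a i, toℕ k < a i) contains a pair of P.
Is2Cover : (m : ℕ) (a : Fin m → ℕ) → PairSet m (width m a) → Set
Is2Cover m a P = ∀ (i : Fin m) (j k : Fin (width m a)) →
  toℕ j < a i → toℕ k < a i →
  T (RC P i j ∨ RS P i k ∨ CS P j k)

IsTau2 : (m : ℕ) (a : Fin m → ℕ) → ℕ → Set
IsTau2 m a t =
  (Σ (PairSet m (width m a)) λ P → Is2Cover m a P × size P ≡ t)
  × (∀ P → Is2Cover m a P → t ≤ size P)

-- A matching in the bipartite graph on {c_1..c_ℓ} ∪ {s_1..s_ℓ} with edge set
-- {c_j s_k : j,k ≤ ℓ} \ Q: a list of edges (j , k), pairwise disjoint.
IsMatching : (n ℓ : ℕ) → (Fin n → Fin n → Bool) → List (Fin n × Fin n) → Set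
IsMatching n ℓ Q M =
  All (λ e → toℕ (proj₁ e) < ℓ × toℕ (proj₂ e) < ℓ × ¬ T (Q (proj₁ e) (proj₂ e))) M
  × AllPairs (λ e f → ¬ (proj₁ e ≡ proj₁ f) × ¬ (proj₂ e ≡ proj₂ f)) M

IsMatchingNumber : (n ℓ : ℕ) → (Fin n → Fin n → Bool) → ℕ → Set
IsMatchingNumber n ℓ Q ν =
  (Σ (List (Fin n × Fin n)) λ M → IsMatching n ℓ Q M × length M ≡ ν)
  × (∀ M → IsMatching n ℓ Q M → length M ≤ ν)

{-# OPTIONS --safe #-}
module Submission where

-- In row i, every pair {c_j, s_k} with j, k ≤ a_i that is not in Q leaves the
-- edge {r_i, c_j, s_k} to be covered by r_i c_j or r_i s_k.  Hence the pairs
-- at r_i must form a vertex cover of the bipartite graph of such pairs, and by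
-- König's theorem a minimum one has size ν(a_i, Q).
--
-- König's theorem is proved by induction on the left side.  Let v be the first
-- left vertex and G the graph without v.  If some neighbour j of v can be
-- removed from G without lowering its matching number, a maximum matching of
-- G - j grows by the edge v j, and v together with a minimum cover of G covers
-- everything.  Otherwise every neighbour j lies in some minimum cover of G
-- (a minimum cover of G - j, plus j).  Minimum covers are closed under the meet
-- (left sides intersected, right sides united), because the sizes of meet and
-- join add up to the sizes of the two covers; so a single minimum cover of G
-- contains all neighbours of v, and it covers the whole graph without v.

open import Defs
open import Data.Bool using (Bool; true; false; T; not; _∧_; _∨_; if_then_else_)
open import Data.Bool.Properties using (T-≡; T-∧; T-∨; T-not-≡; T?; ∨-assoc)
open import Data.Empty using (⊥-elim)
open import Data.Fin using (Fin; zero; suc; toℕ; _≟_)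
open import Data.Fin.Properties using (any?; suc-injective)
open import Data.List using (List; []; _∷_; length; map; allFin)
open import Data.List.Properties using (length-map)
open import Data.List.Membership.Propositional using (_∈_)
open import Data.List.Membership.Propositional.Properties using (∈-allFin)
open import Data.List.Relation.Unary.All as All using (All; []; _∷_)
open import Data.List.Relation.Unary.All.Properties as All using ()
open import Data.List.Relation.Unary.AllPairs as AllPairs using (AllPairs; []; _∷_)
open import Data.List.Relation.Unary.AllPairs.Properties as AllPairs using ()
open import Data.List.Relation.Unary.Any using (here; there)
open import Data.Nat using (ℕ; zero; suc; _+_; _≤_; _<_; z≤n; s≤s; _<ᵇ_) renaming (_≟_ to _≟ₙ_)
open import Data.Nat.Properties
  using (≤-antisym; ≤-reflexive; ≤-trans; ≤∧≢⇒<; +-comm; +-suc; +-mono-≤; +-monoˡ-≤; +-monoʳ-≤;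
         +-cancelˡ-≤; m≤m+n; <ᵇ⇒<; <⇒<ᵇ; +-commutativeSemigroup; module ≤-Reasoning)
open import Algebra.Properties.CommutativeSemigroup +-commutativeSemigroup using (interchange)
open import Data.Product using (Σ; _×_; _,_; proj₁; proj₂; map₁)
open import Data.Sum using (inj₁; inj₂)
open import Data.Vec.Functional using () renaming (_∷_ to _◂_)
open import Function.Bundles using (Equivalence; _⇔_; mk⇔)
open import Relation.Binary.PropositionalEquality
open import Relation.Nullary using (¬_; yes; no; does)
open import Relation.Nullary.Decidable using (dec-true; dec-false; _×-dec_)

open Equivalence using (to; from)

Σᶠ-cong : ∀ k {f g : Fin k → ℕ} → (∀ i → f i ≡ g i) → Σᶠ k f ≡ Σᶠ k g
Σᶠ-cong zero    f≗g = refl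
Σᶠ-cong (suc k) f≗g = cong₂ _+_ (f≗g zero) (Σᶠ-cong k (λ i → f≗g (suc i)))

Σᶠ-+ : ∀ k (f g : Fin k → ℕ) → Σᶠ k (λ i → f i + g i) ≡ Σᶠ k f + Σᶠ k g
Σᶠ-+ zero    f g = refl
Σᶠ-+ (suc k) f g = trans (cong (f zero + g zero +_) (Σᶠ-+ k (λ i → f (suc i)) (λ i → g (suc i))))
                         (interchange (f zero) (g zero) _ _)

T-∨-introˡ : ∀ {a} b → T a → T (a ∨ b)
T-∨-introˡ {true} b _ = _

T-∨-introʳ : ∀ a {b} → T b → T (a ∨ b)
T-∨-introʳ true  _ = _
T-∨-introʳ false t = t

indicator : Bool → ℕ
indicator b = if b then 1 else 0

_∪_ _∩_ : ∀ {k} → (Fin k → Bool) → (Fin k → Bool) → Fin k → Bool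
(A ∪ B) x = A x ∨ B x
(A ∩ B) x = A x ∧ B x

｛_｝ : ∀ {k} → Fin k → Fin k → Bool
｛ i ｝ x = does (x ≟ i)

_─_ : ∀ {k} → (Fin k → Bool) → Fin k → Fin k → Bool
(A ─ i) x = if does (x ≟ i) then false else A x

─-≢ : ∀ {k} (A : Fin k → Bool) {i x} → ¬ x ≡ i → (A ─ i) x ≡ A x
─-≢ A {i} {x} x≢i rewrite dec-false (x ≟ i) x≢i = refl

count-false : ∀ k → count k (λ _ → false) ≡ 0
count-false zero    = refl
count-false (suc k) = count-false k

indicator-∪+∩ : ∀ a b → indicator (a ∨ b) + indicator (a ∧ b) ≡ indicator a + indicator b
indicator-∪+∩ true  true  = refl
indicator-∪+∩ true  false = refl
indicator-∪+∩ false true  = refl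
indicator-∪+∩ false false = refl

count-∪+∩ : ∀ k (A B : Fin k → Bool) → count k (A ∪ B) + count k (A ∩ B) ≡ count k A + count k B
count-∪+∩ zero    A B = refl
count-∪+∩ (suc k) A B = begin
  (indicator (A zero ∨ B zero) + count k (A′ ∪ B′)) + (indicator (A zero ∧ B zero) + count k (A′ ∩ B′))
    ≡⟨ interchange (indicator (A zero ∨ B zero)) _ _ _ ⟩
  (indicator (A zero ∨ B zero) + indicator (A zero ∧ B zero)) + (count k (A′ ∪ B′) + count k (A′ ∩ B′))
    ≡⟨ cong₂ _+_ (indicator-∪+∩ (A zero) (B zero)) (count-∪+∩ k A′ B′) ⟩
  (indicator (A zero) + indicator (B zero)) + (count k A′ + count k B′)
    ≡⟨ interchange (indicator (A zero)) _ _ _ ⟩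
  (indicator (A zero) + count k A′) + (indicator (B zero) + count k B′) ∎
  where
  open ≡-Reasoning
  A′ B′ : Fin k → Bool
  A′ i = A (suc i)
  B′ i = B (suc i)

count-｛｝ : ∀ k (i : Fin k) → count k ｛ i ｝ ≡ 1
count-｛｝ (suc k) zero    = cong suc (count-false k)
count-｛｝ (suc k) (suc i) = count-｛｝ k i

count-∪-｛｝ : ∀ k (A : Fin k → Bool) i → count k (A ∪ ｛ i ｝) ≤ suc (count k A)
count-∪-｛｝ k A i = begin
  count k (A ∪ ｛ i ｝)                                ≤⟨ m≤m+n _ _ ⟩
  count k (A ∪ ｛ i ｝) + count k (A ∩ ｛ i ｝)         ≡⟨ count-∪+∩ k A ｛ i ｝ ⟩
  count k A + count k ｛ i ｝                           ≡⟨ cong (count k A +_) (count-｛｝ k i) ⟩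
  count k A + 1                                        ≡⟨ +-comm (count k A) 1 ⟩
  suc (count k A)                                      ∎
  where open ≤-Reasoning

count-─ : ∀ k (A : Fin k → Bool) i → T (A i) → count k A ≡ suc (count k (A ─ i))
count-─ (suc k) A zero    Ai = cong (λ b → indicator b + count k (λ x → A (suc x))) (to T-≡ Ai)
count-─ (suc k) A (suc i) Ai =
  trans (cong (indicator (A zero) +_) (count-─ k (λ x → A (suc x)) i Ai))
        (+-suc (indicator (A zero)) _)

-- Bipartite graphs, matchings and vertex covers

Graph : ℕ → ℕ → Set
Graph p q = Fin p → Fin q → Bool

Edge : ℕ → ℕ → Set
Edge p q = Fin p × Fin q

Disjoint : ∀ {p q} → Edge p q → Edge p q → Set
Disjoint e f = ¬ proj₁ e ≡ proj₁ f × ¬ proj₂ e ≡ proj₂ f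

_∋ₑ_ : ∀ {p q} → Graph p q → Edge p q → Set
G ∋ₑ e = T (G (proj₁ e) (proj₂ e))

record IsMatchingOf {p q} (G : Graph p q) (M : List (Edge p q)) : Set where
  field
    edges    : All (G ∋ₑ_) M
    disjoint : AllPairs Disjoint M
open IsMatchingOf

record Cover {p q} (G : Graph p q) : Set where
  field
    left   : Fin p → Bool
    right  : Fin q → Bool
    covers : ∀ i j → T (G i j) → T (left i ∨ right j)
open Cover

coverSize : ∀ {p q} {G : Graph p q} → Cover G → ℕ
coverSize {p} {q} C = count p (left C) + count q (right C)

CoveredBy : ∀ {p q} → (Fin p → Bool) → (Fin q → Bool) → Edge p q → Set
CoveredBy A B e = T (A (proj₁ e) ∨ B (proj₂ e))

disjoint-matching≤cover : ∀ {p q} (A : Fin p → Bool) (B : Fin q → Bool) M →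
  AllPairs Disjoint M → All (CoveredBy A B) M → length M ≤ count p A + count q B
disjoint-matching≤cover A B []      _        _        = z≤n
disjoint-matching≤cover {p} {q} A B ((i , j) ∷ M) (d ∷ ds) (c ∷ cs) with to T-∨ c
... | inj₁ Ai = begin
  suc (length M)                       ≤⟨ s≤s (disjoint-matching≤cover (A ─ i) B M ds
                                              (All.zipWith uncoverᵢ (d , cs))) ⟩
  suc (count p (A ─ i) + count q B)    ≡⟨ cong (_+ count q B) (count-─ p A i Ai) ⟨
  count p A + count q B                ∎
  where
  open ≤-Reasoning
  uncoverᵢ : ∀ {e} → Disjoint (i , j) e × CoveredBy A B e → CoveredBy (A ─ i) B e
  uncoverᵢ {e} ((i≢ , _) , c) =
    subst (λ b → T (b ∨ B (proj₂ e))) (sym (─-≢ A (λ eq → i≢ (sym eq)))) c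
... | inj₂ Bj = begin
  suc (length M)                       ≤⟨ s≤s (disjoint-matching≤cover A (B ─ j) M ds
                                              (All.zipWith uncoverⱼ (d , cs))) ⟩
  suc (count p A + count q (B ─ j))    ≡⟨ +-suc (count p A) _ ⟨
  count p A + suc (count q (B ─ j))    ≡⟨ cong (count p A +_) (count-─ q B j Bj) ⟨
  count p A + count q B                ∎
  where
  open ≤-Reasoning
  uncoverⱼ : ∀ {e} → Disjoint (i , j) e × CoveredBy A B e → CoveredBy A (B ─ j) e
  uncoverⱼ {e} ((_ , j≢) , c) =
    subst (λ b → T (A (proj₁ e) ∨ b)) (sym (─-≢ B (λ eq → j≢ (sym eq)))) c

matching≤cover : ∀ {p q} {G : Graph p q} {M} → IsMatchingOf G M → (C : Cover G) →
  length M ≤ coverSize C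
matching≤cover {M = M} m C = disjoint-matching≤cover (left C) (right C) M (disjoint m)
  (All.map (λ {e} → covers C (proj₁ e) (proj₂ e)) (edges m))

_⊆ᴳ_ : ∀ {p q} → Graph p q → Graph p q → Set
G ⊆ᴳ H = ∀ i j → T (G i j) → T (H i j)

IsMatchingOf-mono : ∀ {p q} {G H : Graph p q} {M} → G ⊆ᴳ H → IsMatchingOf G M → IsMatchingOf H M
IsMatchingOf-mono G⊆H m = record
  { edges    = All.map (λ {e} → G⊆H (proj₁ e) (proj₂ e)) (edges m)
  ; disjoint = disjoint m
  }

_⊖_ : ∀ {p q} → Graph p q → Fin q → Graph p q
(G ⊖ j) i j′ = G i j′ ∧ not (does (j′ ≟ j))

⊖-⊆ : ∀ {p q} (G : Graph p q) j → (G ⊖ j) ⊆ᴳ G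
⊖-⊆ G j i j′ e = proj₁ (to T-∧ e)

⊖-avoids : ∀ {p q} (G : Graph p q) {i j j′} → T ((G ⊖ j) i j′) → ¬ j′ ≡ j
⊖-avoids G {j = j} {j′} e j′≡j
  with () ← trans (sym (dec-true (j′ ≟ j) j′≡j)) (to T-not-≡ (proj₂ (to T-∧ e)))

⊖-cover : ∀ {p q} {G : Graph p q} {j} (C : Cover (G ⊖ j)) →
  Σ (Cover G) λ D → coverSize D ≤ suc (coverSize C) × T (right D j)
⊖-cover {p} {q} {G} {j} C = D , size≤ , T-∨-introʳ (right C j) (from T-≡ (dec-true (j ≟ j) refl))
  where
  D : Cover G
  D = record
    { left   = left C
    ; right  = right C ∪ ｛ j ｝
    ; covers = covers′
    }
    where
    covers′ : ∀ i j′ → T (G i j′) → T (left C i ∨ (right C j′ ∨ does (j′ ≟ j)))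
    covers′ i j′ e with j′ ≟ j | covers C i j′
    ... | yes _ | _   = T-∨-introʳ (left C i) (T-∨-introʳ (right C j′) _)
    ... | no  _ | cov = subst T (∨-assoc (left C i) (right C j′) false)
                          (T-∨-introˡ false (cov (from T-∧ (e , _))))
  size≤ : coverSize D ≤ suc (coverSize C)
  size≤ = begin
    count p (left C) + count q (right C ∪ ｛ j ｝)   ≤⟨ +-monoʳ-≤ (count p (left C)) (count-∪-｛｝ q (right C) j) ⟩
    count p (left C) + suc (count q (right C))     ≡⟨ +-suc (count p (left C)) _ ⟩
    suc (coverSize C)                              ∎
    where open ≤-Reasoning

-- The lattice of vertex covers

T-∨-meet : ∀ a b a′ b′ → T (a ∨ b) → T (a′ ∨ b′) → T ((a ∧ a′) ∨ (b ∨ b′))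
T-∨-meet true  b true  b′ _ _  = _
T-∨-meet true  b false b′ _ t′ = T-∨-introʳ b t′
T-∨-meet false b a′    b′ t _  = T-∨-introˡ b′ t

T-∨-join : ∀ a b a′ b′ → T (a ∨ b) → T (a′ ∨ b′) → T ((a ∨ a′) ∨ (b ∧ b′))
T-∨-join true  b a′    b′ _ _  = _
T-∨-join false b true  b′ _ _  = _
T-∨-join false b false b′ t t′ = from T-∧ (t , t′)

_⊓_ _⊔_ : ∀ {p q} {G : Graph p q} → Cover G → Cover G → Cover G
C ⊓ D = record
  { left   = left C ∩ left D
  ; right  = right C ∪ right D
  ; covers = λ i j e → T-∨-meet (left C i) (right C j) (left D i) (right D j) (covers C i j e) (covers D i j e)
  }
C ⊔ D = record
  { left   = left C ∪ left D
  ; right  = right C ∩ right D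
  ; covers = λ i j e → T-∨-join (left C i) (right C j) (left D i) (right D j) (covers C i j e) (covers D i j e)
  }

coverSize-⊔+⊓ : ∀ {p q} {G : Graph p q} (C D : Cover G) →
  coverSize (C ⊔ D) + coverSize (C ⊓ D) ≡ coverSize C + coverSize D
coverSize-⊔+⊓ {p} {q} C D = begin
  (count p (A ∪ A′) + count q (B ∩ B′)) + (count p (A ∩ A′) + count q (B ∪ B′))
    ≡⟨ interchange (count p (A ∪ A′)) _ _ _ ⟩
  (count p (A ∪ A′) + count p (A ∩ A′)) + (count q (B ∩ B′) + count q (B ∪ B′))
    ≡⟨ cong₂ _+_ (count-∪+∩ p A A′) (trans (+-comm (count q (B ∩ B′)) _) (count-∪+∩ q B B′)) ⟩
  (count p A + count p A′) + (count q B + count q B′)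
    ≡⟨ interchange (count p A) _ _ _ ⟩
  (count p A + count q B) + (count p A′ + count q B′) ∎
  where
  open ≡-Reasoning
  A A′ : Fin p → Bool
  A = left C
  A′ = left D
  B B′ : Fin q → Bool
  B = right C
  B′ = right D

⊓-minimum : ∀ {p q} {G : Graph p q} {k} → (∀ (E : Cover G) → k ≤ coverSize E) →
  (C D : Cover G) → coverSize C ≤ k → coverSize D ≤ k → coverSize (C ⊓ D) ≤ k
⊓-minimum {k = k} minimal C D C≤k D≤k = +-cancelˡ-≤ k _ _ (begin
  k + coverSize (C ⊓ D)                  ≤⟨ +-monoˡ-≤ _ (minimal (C ⊔ D)) ⟩
  coverSize (C ⊔ D) + coverSize (C ⊓ D)  ≡⟨ coverSize-⊔+⊓ C D ⟩
  coverSize C + coverSize D              ≤⟨ +-mono-≤ C≤k D≤k ⟩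
  k + k                                  ∎)
  where open ≤-Reasoning

SmallCoverThrough : ∀ {p q} (G : Graph p q) → ℕ → (Fin q → Set) → Set
SmallCoverThrough G k N = Σ (Cover G) λ C → coverSize C ≤ k × (∀ j → N j → T (right C j))

minimumCoverThrough : ∀ {p q} {G : Graph p q} {k} → (∀ (E : Cover G) → k ≤ coverSize E) →
  (C₀ : Cover G) → coverSize C₀ ≤ k → (N : Fin q → Bool) →
  (∀ j → T (N j) → Σ (Cover G) λ D → coverSize D ≤ k × T (right D j)) →
  SmallCoverThrough G k (λ j → T (N j))
minimumCoverThrough {q = q} {G} {k} minimal C₀ C₀≤k N through =
  let C , C≤k , inC = throughList (allFin q) in C , C≤k , λ j Nj → inC j (∈-allFin j , Nj)
  where
  throughList : (L : List (Fin q)) → SmallCoverThrough G k (λ j → j ∈ L × T (N j))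
  throughList []      = C₀ , C₀≤k , λ _ ()
  throughList (j ∷ L) with throughList L | T? (N j)
  ... | C , C≤k , inC | no ¬Nj = C , C≤k , λ
    { _ (here refl , Nj) → ⊥-elim (¬Nj Nj)
    ; j′ (there j′∈L , Nj′) → inC j′ (j′∈L , Nj′) }
  ... | C , C≤k , inC | yes Nj with through j Nj
  ...   | D , D≤k , Dj =
    C ⊓ D , ⊓-minimum minimal C D C≤k D≤k , λ
      { _ (here refl , _) → T-∨-introʳ (right C j) Dj
      ; j′ (there j′∈L , Nj′) → T-∨-introˡ (right D j′) (inC j′ (j′∈L , Nj′)) }

-- König's theorem

record König {p q} (G : Graph p q) : Set where
  field
    matching   : List (Edge p q)
    isMatching : IsMatchingOf G matching
    cover      : Cover G
    tight      : length matching ≡ coverSize cover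
open König

tail : ∀ {p q} → Graph (suc p) q → Graph p q
tail G i = G (suc i)

liftEdges : ∀ {p q} → List (Edge p q) → List (Edge (suc p) q)
liftEdges = map (map₁ suc)

liftMatching : ∀ {p q} {G : Graph (suc p) q} {M} → IsMatchingOf (tail G) M →
  IsMatchingOf G (liftEdges M)
liftMatching m = record
  { edges    = All.map⁺ (edges m)
  ; disjoint = AllPairs.map⁺ (AllPairs.map (λ (i≢ , j≢) → (λ eq → i≢ (suc-injective eq)) , j≢) (disjoint m))
  }

extendMatching : ∀ {p q} {G : Graph (suc p) q} {j M} → T (G zero j) →
  IsMatchingOf (tail G ⊖ j) M → IsMatchingOf G ((zero , j) ∷ liftEdges M)
extendMatching {G = G} {j} {M} e m = record
  { edges    = e ∷ edges lifted
  ; disjoint = All.map⁺ (All.map (λ {f} f∈ → (λ ()) , λ eq → ⊖-avoids (tail G) f∈ (sym eq)) (edges m))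
               ∷ disjoint lifted
  }
  where
  lifted : IsMatchingOf G (liftEdges M)
  lifted = liftMatching (IsMatchingOf-mono (⊖-⊆ (tail G) j) m)

extendCover : ∀ {p q} {G : Graph (suc p) q} (b : Bool) (C : Cover (tail G)) →
  (∀ j → T (G zero j) → T (b ∨ right C j)) → Cover G
extendCover b C neighbours = record
  { left   = b ◂ left C
  ; right  = right C
  ; covers = λ { zero j → neighbours j ; (suc i) j → covers C i j }
  }

matchingSize : ∀ {p q} {G : Graph p q} → König G → ℕ
matchingSize K = length (matching K)

könig-extendByEdge : ∀ {p q} {G : Graph (suc p) q} {j} → T (G zero j) →
  (K : König (tail G)) (Kⱼ : König (tail G ⊖ j)) → matchingSize Kⱼ ≡ matchingSize K → König G
könig-extendByEdge {G = G} {j} e K Kⱼ same = record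
  { matching   = (zero , j) ∷ liftEdges (matching Kⱼ)
  ; isMatching = extendMatching e (isMatching Kⱼ)
  ; cover      = extendCover true (cover K) (λ _ _ → _)
  ; tight      = cong suc (trans (length-map (map₁ suc) (matching Kⱼ)) (trans same (tight K)))
  }

könig-extendByNeighbours : ∀ {p q} {G : Graph (suc p) q} (K : König (tail G))
  (Kⱼ : ∀ j → König (tail G ⊖ j)) →
  (∀ j → T (G zero j) → ¬ matchingSize (Kⱼ j) ≡ matchingSize K) → König G
könig-extendByNeighbours {G = G} K Kⱼ lowers =
  fromCover (minimumCoverThrough minimal (cover K) (≤-reflexive (sym (tight K))) (G zero) neighbourCover)
  where
  k : ℕ
  k = matchingSize K
  minimal : ∀ (C : Cover (tail G)) → k ≤ coverSize C
  minimal = matching≤cover (isMatching K)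
  neighbourCover : ∀ j → T (G zero j) → Σ (Cover (tail G)) λ D → coverSize D ≤ k × T (right D j)
  neighbourCover j e with ⊖-cover (cover (Kⱼ j))
  ... | D , D≤ , Dj = D , ≤-trans D≤ (subst (λ n → suc n ≤ k) (tight (Kⱼ j)) smaller) , Dj
    where
    smaller : matchingSize (Kⱼ j) < k
    smaller = ≤∧≢⇒<
      (subst (matchingSize (Kⱼ j) ≤_) (sym (tight K))
        (matching≤cover (IsMatchingOf-mono (⊖-⊆ (tail G) j) (isMatching (Kⱼ j))) (cover K)))
      (lowers j e)
  fromCover : SmallCoverThrough (tail G) k (λ j → T (G zero j)) → König G
  fromCover (C , C≤k , inC) = record
    { matching   = liftEdges (matching K)
    ; isMatching = lifted
    ; cover      = C′
    ; tight      = ≤-antisym (matching≤cover lifted C′)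
                     (subst (coverSize C′ ≤_) (sym (length-map (map₁ suc) (matching K))) C≤k)
    }
    where
    lifted : IsMatchingOf G (liftEdges (matching K))
    lifted = liftMatching (isMatching K)
    C′ : Cover G
    C′ = extendCover false C inC

könig-extend : ∀ {p q} {G : Graph (suc p) q} → König (tail G) → (∀ j → König (tail G ⊖ j)) → König G
könig-extend {G = G} K Kⱼ
  with any? (λ j → T? (G zero j) ×-dec (matchingSize (Kⱼ j) ≟ₙ matchingSize K))
... | yes (j , e , same) = könig-extendByEdge e K (Kⱼ j) same
... | no none            = könig-extendByNeighbours K Kⱼ (λ j e same → none (j , e , same))

könig : ∀ {p q} (G : Graph p q) → König G
könig {zero} {q} G = record
  { matching   = []
  ; isMatching = record { edges = [] ; disjoint = [] }
  ; cover      = record { left = λ () ; right = λ _ → false ; covers = λ () }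
  ; tight      = sym (count-false q)
  }
könig {suc p} G = könig-extend (könig (tail G)) (λ j → könig (tail G ⊖ j))

T-not : ∀ {b} → T (not b) ⇔ (¬ T b)
T-not {true}  = mk⇔ (λ ()) (λ ¬t → ¬t _)
T-not {false} = mk⇔ (λ _ ()) (λ _ → _)

rowGraph : (n ℓ : ℕ) → (Fin n → Fin n → Bool) → Graph n n
rowGraph n ℓ Q j k = (toℕ j <ᵇ ℓ) ∧ ((toℕ k <ᵇ ℓ) ∧ not (Q j k))

RowEdge : (n ℓ : ℕ) → (Fin n → Fin n → Bool) → Edge n n → Set
RowEdge n ℓ Q e = toℕ (proj₁ e) < ℓ × toℕ (proj₂ e) < ℓ × ¬ T (Q (proj₁ e) (proj₂ e))

rowGraph-∋ₑ : ∀ {n ℓ} Q e → rowGraph n ℓ Q ∋ₑ e ⇔ RowEdge n ℓ Q e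
rowGraph-∋ₑ {ℓ = ℓ} Q (j , k) = mk⇔
  (λ e → let (j< , e′) = to T-∧ e ; (k< , ¬q) = to T-∧ e′ in
         <ᵇ⇒< (toℕ j) ℓ j< , <ᵇ⇒< (toℕ k) ℓ k< , to T-not ¬q)
  (λ (j< , k< , ¬q) → from T-∧ (<⇒<ᵇ j< , from T-∧ (<⇒<ᵇ k< , from T-not ¬q)))

rowGraph-matching : ∀ {n ℓ Q M} → IsMatchingOf (rowGraph n ℓ Q) M ⇔ IsMatching n ℓ Q M
rowGraph-matching {Q = Q} = mk⇔
  (λ m → All.map (λ {e} → to (rowGraph-∋ₑ Q e)) (edges m) , disjoint m)
  (λ (es , d) → record { edges = All.map (λ {e} → from (rowGraph-∋ₑ Q e)) es ; disjoint = d })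

coverSize≡matchingNumber : ∀ {n ℓ Q ν} (K : König (rowGraph n ℓ Q)) →
  IsMatchingNumber n ℓ Q ν → coverSize (cover K) ≡ ν
coverSize≡matchingNumber K ((M , m , refl) , maximum) = ≤-antisym
  (subst (_≤ length M) (tight K) (maximum _ (to rowGraph-matching (isMatching K))))
  (matching≤cover (from rowGraph-matching m) (cover K))

corollary2p5 : (m : ℕ) (a : Fin m → ℕ) → IsYoung m a →
    (Q : Fin (width m a) → Fin (width m a) → Bool) →
    Σ (PairSet m (width m a)) λ P →
      Is2Cover m a P
      × (∀ j k → CS P j k ≡ Q j k)
      × (∀ t → IsTau2 m a t → t ≤ size P)
      × (∀ (ν : Fin m → ℕ) → (∀ i → IsMatchingNumber (width m a) (a i) Q (ν i)) →
           size P ≡ count₂ (width m a) (width m a) Q + Σᶠ m ν)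
corollary2p5 m a _ Q = P , is2Cover , (λ _ _ → refl) , (λ _ τ → proj₂ τ P is2Cover) , sizeP
  where
  n : ℕ
  n = width m a
  K : (i : Fin m) → König (rowGraph n (a i) Q)
  K i = könig (rowGraph n (a i) Q)
  C : (i : Fin m) → Cover (rowGraph n (a i) Q)
  C i = cover (K i)
  P : PairSet m n
  P = record { RC = λ i → left (C i) ; RS = λ i → right (C i) ; CS = Q }
  is2Cover : Is2Cover m a P
  is2Cover i j k j<a k<a with T? (Q j k)
  ... | yes q = T-∨-introʳ (left (C i) j) (T-∨-introʳ (right (C i) k) q)
  ... | no ¬q = subst T (∨-assoc (left (C i) j) (right (C i) k) (Q j k))
                  (T-∨-introˡ (Q j k) (covers (C i) j k (from (rowGraph-∋ₑ Q (j , k)) (j<a , k<a , ¬q))))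
  sizeP : ∀ ν → (∀ i → IsMatchingNumber n (a i) Q (ν i)) → size P ≡ count₂ n n Q + Σᶠ m ν
  sizeP ν isν = begin
    count₂ m n (RC P) + count₂ m n (RS P) + count₂ n n Q   ≡⟨ +-comm _ (count₂ n n Q) ⟩
    count₂ n n Q + (count₂ m n (RC P) + count₂ m n (RS P)) ≡⟨ cong (count₂ n n Q +_) (Σᶠ-+ m _ _) ⟨
    count₂ n n Q + Σᶠ m (λ i → coverSize (C i))            ≡⟨ cong (count₂ n n Q +_) (Σᶠ-cong m λ i →
                                                                coverSize≡matchingNumber (K i) (isν i)) ⟩
    count₂ n n Q + Σᶠ m ν                                  ∎
    where open ≡-Reasoning
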